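{- Let $t_\beta$ and $t_\eta$ be the direct $\beta$- and $\eta$-witnesses from $M=((\lambda z.\,xz)\,y)$ to $N=xy$. In the canonical identity-type higher tower on $K_\infty$, their canonical interpretations $[\![t_\beta]\!]_{K_\infty}$ and $[\![t_\eta]\!]_{K_\infty}$ are: (i) distinct as $K_\infty$-points; (ii) not connected by any $1$-cell, i.e., by any equality in the carrier of $K_\infty$; (iii) consequently not connected by any higher cell in any positive dimension of that tower. The same conclusion holds for any pair of witnesses in the fixed-span language $W(M,N)$ whose canonical tags are $\beta$ and $\eta$, respectively.
   Context: $K_\infty=\varprojlim_n K_n$ is the inverse limit of $K_0=N^+$ (flat domain on $\bigsqcup_{n\ge0}S^n$ plus bottom), $K_{n+1}=[K_n\to K_n]$, along projection pairs $(f_n^+,f_n^-)$; $f_{0,\infty}:K_0\to K_\infty$ is the canonical stage embedding and $\pi_0$ the $0$th projection. The canonical higher tower on $K_\infty$ is the identity-type tower: $1$-cells $x\to y$ are equalities $x=y$, higher cells iterated equalities. On the span $M=((\lambda z.\,xz)\,y)\to N=xy$ there are two one-step witnesses: $t_\beta$ (the $\beta$-contraction) and $t_\eta$ ($\eta$-contraction $\lambda z.\,xz\to_\eta x$ in the function part). $W(A,B)$ for $A,B\in\{M,N\}$ is the typed family generated by $t_\beta,t_\eta:W(M,N)$, $\mathsf{refl}_M,\mathsf{refl}_N$, and composition (no inverses). Every $t\in W(M,N)$ is the direct $\beta$- or $\eta$-witness padded by reflexive witnesses, giving a well-defined tag $\mathrm{tag}(t)\in\{\beta,\eta\}$. With $s^R_1,s^L_1$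 the right and left poles of the $S^1$-summand of $K_0$'s base, the interpretation $[\![t]\!]_{K_\infty}$ (semantic interpretation of $t$ in $K_\infty$) is $f_{0,\infty}(s^R_1)$ if $\mathrm{tag}(t)=\beta$ and $f_{0,\infty}(s^L_1)$ if $\mathrm{tag}(t)=\eta$. -}

module Defs where

open import Data.Nat using (ℕ; zero; suc; _≤_; z≤n; s≤s)
open import Data.Nat.Properties using (≤-total)
open import Data.Product using (Σ; _×_; _,_; proj₁; proj₂)
open import Data.Sum using (_⊎_; inj₁; inj₂)
open import Data.Maybe using (Maybe; just; nothing)
open import Data.Empty using (⊥-elim)
open import Relation.Nullary using (¬_)
open import Relation.Binary.PropositionalEquality using (_≡_; refl)

-- Ambient classical logic (needed to form lubs in the flat domain N⁺)

LEM : Set₁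
LEM = (A : Set) → A ⊎ ¬ A

record Dom : Set₁ where
  field
    C       : Set
    _⊑_     : C → C → Set
    ⊑-refl  : ∀ {x} → x ⊑ x
    ⊑-trans : ∀ {x y z} → x ⊑ y → y ⊑ z → x ⊑ z
    bot     : C
    bot-min : ∀ {x} → bot ⊑ x
    ⨆       : (c : ℕ → C) → (∀ i → c i ⊑ c (suc i)) → C
    ⨆-ub    : ∀ c p i → c i ⊑ ⨆ c p
    ⨆-lub   : ∀ c p u → (∀ i → c i ⊑ u) → ⨆ c p ⊑ u

  _≈_ : C → C → Set
  x ≈ y = (x ⊑ y) × (y ⊑ x)

  ⨆-mono : ∀ c p d q → (∀ i → c i ⊑ d i) → ⨆ c p ⊑ ⨆ d q
  ⨆-mono c p d q h = ⨆-lub c p (⨆ d q) (λ i → ⊑-trans (h i) (⨆-ub d q i))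

open Dom

record Cont (D E : Dom) : Set where
  field
    fun  : C D → C E
    mono : ∀ {x y} → _⊑_ D x y → _⊑_ E (fun x) (fun y)
    cont : ∀ c p → _⊑_ E (fun (⨆ D c p)) (⨆ E (λ i → fun (c i)) (λ i → mono (p i)))

open Cont

_∘c_ : ∀ {D E F} → Cont E F → Cont D E → Cont D F
_∘c_ {F = F} f g = record
  { fun  = λ x → fun f (fun g x)
  ; mono = λ h → mono f (mono g h)
  ; cont = λ c p → ⊑-trans F (mono f (cont g c p))
                     (cont f (λ i → fun g (c i)) (λ i → mono g (p i)))
  }

module FunSpace (D E : Dom) where
  private
    module D = Dom D
    module E = Dom E

  _≤F_ : Cont D E → Cont D E → Set
  f ≤F g = ∀ x → fun f x E.⊑ fun g x

  botF : Cont D E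
  botF = record { fun = λ _ → E.bot ; mono = λ _ → E.⊑-refl ; cont = λ c p → E.bot-min }

  supMono : ∀ (G : ℕ → Cont D E) (P : ∀ i → G i ≤F G (suc i)) {x y} → x D.⊑ y →
            E.⨆ (λ i → fun (G i) x) (λ i → P i x) E.⊑ E.⨆ (λ i → fun (G i) y) (λ i → P i y)
  supMono G P {x} {y} h = E.⨆-mono _ _ _ _ (λ i → mono (G i) h)

  supF : (G : ℕ → Cont D E) → (∀ i → G i ≤F G (suc i)) → Cont D E
  supF G P = record
    { fun  = λ x → E.⨆ (λ i → fun (G i) x) (λ i → P i x)
    ; mono = supMono G P
    ; cont = λ c p → E.⨆-lub _ _ _ (λ i →
               E.⊑-trans (cont (G i) c p)
                 (E.⨆-lub _ _ _ (λ j →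
                   E.⊑-trans (E.⨆-ub (λ i' → fun (G i') (c j)) (λ i' → P i' (c j)) i)
                     (E.⨆-ub (λ j' → E.⨆ (λ i' → fun (G i') (c j')) (λ i' → P i' (c j')))
                             (λ j' → supMono G P (p j')) j))))
    }

_⇒_ : Dom → Dom → Dom
D ⇒ E = record
  { C = Cont D E
  ; _⊑_ = _≤F_
  ; ⊑-refl = λ x → ⊑-refl E
  ; ⊑-trans = λ f g x → ⊑-trans E (f x) (g x)
  ; bot = botF
  ; bot-min = λ x → bot-min E
  ; ⨆ = supF
  ; ⨆-ub = λ G P i x → ⨆-ub E (λ i' → fun (G i') x) (λ i' → P i' x) i
  ; ⨆-lub = λ G P u h x → ⨆-lub E (λ i' → fun (G i') x) (λ i' → P i' x) (fun u x) (λ i → h i x)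
  }
  where open FunSpace D E

data FlatLe {B : Set} : Maybe B → Maybe B → Set where
  bot≤ : ∀ {y} → FlatLe nothing y
  rfl≤ : ∀ {x} → FlatLe x x

module FlatDomain (lem : LEM) (B : Set) where

  flat-trans : ∀ {x y z : Maybe B} → FlatLe x y → FlatLe y z → FlatLe x z
  flat-trans bot≤ _ = bot≤
  flat-trans rfl≤ q = q

  flat-just : ∀ {b : B} {y} → FlatLe (just b) y → y ≡ just b
  flat-just rfl≤ = refl

  chain-le : ∀ (c : ℕ → Maybe B) → (∀ i → FlatLe (c i) (c (suc i))) →
             ∀ {i j} → i ≤ j → FlatLe (c i) (c j)
  chain-le c p {zero} {zero} z≤n = rfl≤
  chain-le c p {zero} {suc j} z≤n = flat-trans (chain-le c p {zero} {j} z≤n) (p j)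
  chain-le c p {suc i} {suc j} (s≤s h) = chain-le (λ k → c (suc k)) (λ k → p (suc k)) h

  Defined : (ℕ → Maybe B) → Set
  Defined c = Σ ℕ (λ i → Σ B (λ b → c i ≡ just b))

  flatSup : (c : ℕ → Maybe B) → (∀ i → FlatLe (c i) (c (suc i))) → Maybe B
  flatSup c p with lem (Defined c)
  ... | inj₁ (i , b , _) = just b
  ... | inj₂ _ = nothing

  flatSup-ub : ∀ c p i → FlatLe (c i) (flatSup c p)
  flatSup-ub c p j with lem (Defined c)
  ... | inj₂ nd with c j in eq
  ...   | nothing = bot≤
  ...   | just b = ⊥-elim (nd (j , b , eq))
  flatSup-ub c p j | inj₁ (i , b , eq) with ≤-total j i
  ... | inj₁ j≤i with chain-le c p j≤i
  ...   | le rewrite eq = le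
  flatSup-ub c p j | inj₁ (i , b , eq) | inj₂ i≤j with chain-le c p i≤j
  ...   | le rewrite eq | flat-just le = rfl≤

  flatSup-lub : ∀ c p u → (∀ i → FlatLe (c i) u) → FlatLe (flatSup c p) u
  flatSup-lub c p u h with lem (Defined c)
  ... | inj₁ (i , b , eq) with h i
  ...   | le rewrite eq = le
  flatSup-lub c p u h | inj₂ _ = bot≤

  Flat : Dom
  Flat = record
    { C = Maybe B ; _⊑_ = FlatLe ; ⊑-refl = rfl≤ ; ⊑-trans = flat-trans
    ; bot = nothing ; bot-min = bot≤
    ; ⨆ = flatSup ; ⨆-ub = flatSup-ub ; ⨆-lub = flatSup-lub }

data Tm : Set where
  M N : Tm

data Tag : Set where
  β η : Tag

data W : Tm → Tm → Set where
  tβ tη : W M N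
  rflW  : ∀ A → W A A
  _⨾_   : ∀ {A B D} → W A B → W B D → W A D

-- canonical tag of a witness in W(M,N): the tag of its unique direct witness
tag : W M N → Tag
tag tβ = β
tag tη = η
tag (_⨾_ {B = M} s t) = tag t
tag (_⨾_ {B = N} s t) = tag s

-- Identity-type higher tower: IdCell A a b k = the (k+1)-cells from a to b
-- (k = 0: equalities a ≡ b; k+1: a (k+1)-cell between two parallel equalities)

IdCell : (A : Set) → A → A → ℕ → Set
IdCell A a b zero = a ≡ b
IdCell A a b (suc k) = Σ (a ≡ b) (λ q → Σ (a ≡ b) (λ r → IdCell (a ≡ b) q r k))

module Construction (lem : LEM) (S : ℕ → Set) (sR sL : S 1) where

  Base : Set
  Base = Σ ℕ S

  K₀ : Dom
  K₀ = FlatDomain.Flat lem Base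

  mutual
    K : ℕ → Dom
    K zero = K₀
    K (suc n) = K n ⇒ K n

    f⁺ : ∀ n → Cont (K n) (K (suc n))
    f⁺ zero = record
      { fun = λ x → record { fun = λ _ → x ; mono = λ _ → ⊑-refl K₀
                           ; cont = λ c p → ⨆-ub K₀ (λ _ → x) (λ _ → ⊑-refl K₀) 0 }
      ; mono = λ h z → h
      ; cont = λ c p z → ⊑-refl K₀ }
    f⁺ (suc n) = record
      { fun = λ g → f⁺ n ∘c (g ∘c f⁻ n)
      ; mono = λ h x → mono (f⁺ n) (h (fun (f⁻ n) x))
      ; cont = λ G P x → cont (f⁺ n) (λ i → fun (G i) (fun (f⁻ n) x)) (λ i → P i (fun (f⁻ n) x)) }

    f⁻ : ∀ n → Cont (K (suc n)) (K n)
    f⁻ zero = record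
      { fun = λ g → fun g (bot K₀)
      ; mono = λ h → h (bot K₀)
      ; cont = λ G P → ⊑-refl K₀ }
    f⁻ (suc n) = record
      { fun = λ h → f⁻ n ∘c (h ∘c f⁺ n)
      ; mono = λ h x → mono (f⁻ n) (h (fun (f⁺ n) x))
      ; cont = λ G P x → cont (f⁻ n) (λ i → fun (G i) (fun (f⁺ n) x)) (λ i → P i (fun (f⁺ n) x)) }

  retract : ∀ n y → _≈_ (K n) (fun (f⁻ n) (fun (f⁺ n) y)) y
  retract zero y = ⊑-refl K₀ , ⊑-refl K₀
  retract (suc n) g =
      (λ x → ⊑-trans (K n) (proj₁ (retract n (fun g (fun (f⁻ n) (fun (f⁺ n) x)))))
                           (mono g (proj₁ (retract n x))))
    , (λ x → ⊑-trans (K n) (mono g (proj₂ (retract n x)))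
                           (proj₂ (retract n (fun g (fun (f⁻ n) (fun (f⁺ n) x))))))

  record K∞ : Set where
    constructor thread
    field
      th  : (n : ℕ) → C (K n)
      coh : ∀ n → _≈_ (K n) (fun (f⁻ n) (th (suc n))) (th n)

  open K∞ public

  _≈∞_ : K∞ → K∞ → Set
  x ≈∞ y = ∀ n → _≈_ (K n) (th x n) (th y n)

  f₀ : ∀ n → C K₀ → C (K n)
  f₀ zero x = x
  f₀ (suc n) x = fun (f⁺ n) (f₀ n x)

  f₀∞ : C K₀ → K∞
  f₀∞ x = thread (λ n → f₀ n x) (λ n → retract n (f₀ n x))

  π₀ : K∞ → C K₀
  π₀ x = th x 0

  -- the poles of the S¹-summand, as points of K₀
  s¹R s¹L : C K₀
  s¹R = just (1 , sR)
  s¹L = just (1 , sL)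

  interpTag : Tag → K∞
  interpTag β = f₀∞ s¹R
  interpTag η = f₀∞ s¹L

  ⟦_⟧ : W M N → K∞
  ⟦ t ⟧ = interpTag (tag t)

-- The two interpretations are threads whose stage-0 components are the poles
-- just (1 , sR) and just (1 , sL) of the flat domain K₀, and distinct defined
-- points of a flat domain are incomparable. Hence the threads are not even
-- componentwise equivalent; an equality would make them so, and every cell of
-- the identity tower, in any dimension, has an underlying equality.
module Submission where

open import Defs
open import Data.Nat using (ℕ; zero; suc)
open import Data.Nat.Properties using (≡-irrelevant)
open import Data.Product using (_×_; _,_; proj₁)
open import Data.Product.Properties using (,-injectiveʳ-UIP)
open import Data.Maybe using (just)
open import Relation.Nullary using (¬_)
open import Relation.Binary.Definitions using (Reflexive)
open import Relation.Binary.PropositionalEquality using (_≡_; refl; sym; subst₂)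

IdCell⇒≡ : ∀ {A : Set} {a b : A} k → IdCell A a b k → a ≡ b
IdCell⇒≡ zero    a≡b       = a≡b
IdCell⇒≡ (suc k) (a≡b , _) = a≡b

Apart : {A : Set} → (A → A → Set) → A → A → Set
Apart {A} _≈_ x y = (¬ x ≈ y) × (¬ x ≡ y) × (∀ k → ¬ IdCell A x y k)

module _ {A : Set} {_≈_ : A → A → Set} (≈-refl : Reflexive _≈_) {x y : A} where

  ≉⇒≢ : ¬ x ≈ y → ¬ x ≡ y
  ≉⇒≢ x≉y refl = x≉y ≈-refl

  ≉⇒Apart : ¬ x ≈ y → Apart _≈_ x y
  ≉⇒Apart x≉y = x≉y , ≉⇒≢ x≉y , λ k c → ≉⇒≢ x≉y (IdCell⇒≡ k c)

just⊑just⇒≡ : ∀ {B : Set} {a b : B} → FlatLe (just a) (just b) → a ≡ b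
just⊑just⇒≡ rfl≤ = refl

module _ (lem : LEM) (S : ℕ → Set) (sR sL : S 1) where
  open Construction lem S sR sL
  open Dom using (⊑-refl)

  ≈∞-refl : Reflexive _≈∞_
  ≈∞-refl n = ⊑-refl (K n) , ⊑-refl (K n)

  poles-≉∞ : ¬ sR ≡ sL → ¬ interpTag β ≈∞ interpTag η
  poles-≉∞ sR≢sL h = sR≢sL (,-injectiveʳ-UIP ≡-irrelevant (just⊑just⇒≡ (proj₁ (h 0))))

  tagged-Apart : ¬ sR ≡ sL → ∀ t t′ → tag t ≡ β → tag t′ ≡ η → Apart _≈∞_ ⟦ t ⟧ ⟦ t′ ⟧
  tagged-Apart sR≢sL t t′ t:β t′:η = ≉⇒Apart {_≈_ = _≈∞_} (λ {x} → ≈∞-refl {x})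
    (subst₂ (λ a b → ¬ interpTag a ≈∞ interpTag b) (sym t:β) (sym t′:η) (poles-≉∞ sR≢sL))

theoremC : (lem : LEM) (S : ℕ → Set) (sR sL : S 1) → ¬ (sR ≡ sL) →
    let open Construction lem S sR sL in
      ((¬ (⟦ tβ ⟧ ≈∞ ⟦ tη ⟧)) × (¬ (⟦ tβ ⟧ ≡ ⟦ tη ⟧))
        × (∀ (k : ℕ) → ¬ IdCell K∞ ⟦ tβ ⟧ ⟦ tη ⟧ k))
      × (∀ (t t′ : W M N) → tag t ≡ β → tag t′ ≡ η →
          (¬ (⟦ t ⟧ ≈∞ ⟦ t′ ⟧)) × (¬ (⟦ t ⟧ ≡ ⟦ t′ ⟧))
            × (∀ (k : ℕ) → ¬ IdCell K∞ ⟦ t ⟧ ⟦ t′ ⟧ k))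
theoremC lem S sR sL sR≢sL =
  tagged-Apart lem S sR sL sR≢sL tβ tη refl refl , tagged-Apart lem S sR sL sR≢sL
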